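{- Let $U\colon \mathcal{E}\to\mathbf{Set}$ be a topological category and let $\overline T$ be a monad on $\mathcal{E}$ lifting a monad $T$ on $\mathbf{Set}$. Let $(A,a)$ and $(B,b)$ be $\overline T$-algebras and let $h\colon A\to B$ be a $\overline T$-algebra homomorphism. Then $h^\bullet B$ is a refinement of $(A,a)$.
   Context: $U\colon\mathcal{E}\to\mathbf{Set}$ is topological: every $U$-structured source has a unique $U$-initial lift. For a set $X$, the fibre $\mathcal{E}_X$ consists of objects $P$ with $UP=X$, preordered by $P\sqsubseteq P'$ iff there is a morphism $P\to P'$ mapped by $U$ to $\mathit{id}_X$. For an $\mathcal{E}$-morphism $h\colon A\to B$, $h^\bullet B\in\mathcal{E}_{UA}$ is the domain of the initial lift of the single-morphism source $Uh\colon UA\to UB$. A monad $\overline T$ on $\mathcal{E}$ lifts $T$ if $U\overline T=TU$ and $U$ maps unit and multiplication of $\overline T$ to those of $T$. An object $P\in\mathcal{E}_{UA}$ is a refinement of a $\overline T$-algebra $(A,a)$ if $A\sqsubseteq P$ and there is a $\overline T$-algebra structure $p$ on $P$ such that the morphism $\iota_{A,P}\colon A\to P$ with $U\iota_{A,P}=\mathit{id}_{UA}$ is a homomorphism $(A,a)\to(P,p)$. -}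

module Defs where

open import Level using (Level; _⊔_; Lift; lift) renaming (suc to lsuc)
open import Data.Unit using (⊤; tt)
open import Data.Product using (Σ; Σ-syntax; _×_; _,_; proj₁; proj₂)
open import Relation.Binary.PropositionalEquality using (_≡_; refl; subst)
open import Relation.Binary using (Rel; IsEquivalence)

cast : ∀ {ℓ} {X Y : Set ℓ} → X ≡ Y → X → Y
cast refl x = x

record Category (o m e : Level) : Set (lsuc (o ⊔ m ⊔ e)) where
  infix  4 _≈_
  infixr 9 _∘_
  field
    Obj   : Set o
    _⇒_   : Obj → Obj → Set m
    _≈_   : ∀ {A B} → Rel (A ⇒ B) e
    id    : ∀ {A} → A ⇒ A
    _∘_   : ∀ {A B C} → B ⇒ C → A ⇒ B → A ⇒ C
    ≈-equiv   : ∀ {A B} → IsEquivalence (_≈_ {A} {B})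
    ∘-resp-≈  : ∀ {A B C} {f g : B ⇒ C} {h i : A ⇒ B} → f ≈ g → h ≈ i → f ∘ h ≈ g ∘ i
    identityˡ : ∀ {A B} {f : A ⇒ B} → id ∘ f ≈ f
    identityʳ : ∀ {A B} {f : A ⇒ B} → f ∘ id ≈ f
    assoc     : ∀ {A B C D} {f : A ⇒ B} {g : B ⇒ C} {h : C ⇒ D} →
                (h ∘ g) ∘ f ≈ h ∘ (g ∘ f)

record SetFunctor {o m e} (E : Category o m e) (ℓ : Level) : Set (o ⊔ m ⊔ e ⊔ lsuc ℓ) where
  open Category E
  field
    F₀    : Obj → Set ℓ
    F₁    : ∀ {A B} → A ⇒ B → F₀ A → F₀ B
    F-resp : ∀ {A B} {f g : A ⇒ B} → f ≈ g → ∀ x → F₁ f x ≡ F₁ g x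
    F-id  : ∀ {A} (x : F₀ A) → F₁ (id {A}) x ≡ x
    F-∘   : ∀ {A B C} (f : A ⇒ B) (g : B ⇒ C) (x : F₀ A) → F₁ (g ∘ f) x ≡ F₁ g (F₁ f x)

module _ {o m e ℓ} {E : Category o m e} (U : SetFunctor E ℓ) where
  open Category E
  open SetFunctor U

  record Source {i} (X : Set ℓ) (I : Set i) : Set (o ⊔ ℓ ⊔ i) where
    field
      dom : I → Obj
      arr : (k : I) → X → F₀ (dom k)

  record SourceLift {i} {X : Set ℓ} {I : Set i} (S : Source X I) : Set (o ⊔ m ⊔ lsuc ℓ ⊔ i) where
    open Source S
    field
      obj     : Obj
      obj-U   : F₀ obj ≡ X
      mor     : (k : I) → obj ⇒ dom k
      mor-U   : (k : I) (x : F₀ obj) → F₁ (mor k) x ≡ arr k (cast obj-U x)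

  IsInitial : ∀ {i} {X : Set ℓ} {I : Set i} {S : Source X I} → SourceLift S → Set (o ⊔ m ⊔ ℓ ⊔ i)
  IsInitial {X = X} {I} {S} L =
    ∀ (C : Obj) (φ : F₀ C → X) →
      ((k : I) → Σ[ hk ∈ C ⇒ dom k ] (∀ y → F₁ hk y ≡ arr k (φ y))) →
      Σ[ φ̄ ∈ C ⇒ obj ] (∀ y → cast obj-U (F₁ φ̄ y) ≡ φ y)
    where open Source S
          open SourceLift L

  record InitialLift {i} {X : Set ℓ} {I : Set i} (S : Source X I) : Set (o ⊔ m ⊔ lsuc ℓ ⊔ i) where
    field
      lifted    : SourceLift S
      isInitial : IsInitial lifted
    open SourceLift lifted public

  SameLift : ∀ {i} {X : Set ℓ} {I : Set i} {S : Source X I} → SourceLift S → SourceLift S → Set (o ⊔ e ⊔ i)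
  SameLift {I = I} {S} L L' =
    Σ[ p ∈ SourceLift.obj L ≡ SourceLift.obj L' ]
      ((k : I) → subst (λ O → O ⇒ Source.dom S k) p (SourceLift.mor L k) ≈ SourceLift.mor L' k)

  record IsTopological (i : Level) : Set (o ⊔ m ⊔ e ⊔ lsuc ℓ ⊔ lsuc i) where
    field
      initialLift : ∀ (X : Set ℓ) (I : Set i) (S : Source X I) → InitialLift S
      unique      : ∀ (X : Set ℓ) (I : Set i) (S : Source X I) (L : InitialLift S) →
                    SameLift (InitialLift.lifted L) (InitialLift.lifted (initialLift X I S))

  _⊑[_,_] : ∀ {X : Set ℓ} (P : Obj) → F₀ P ≡ X → ∀ {P' : Obj} → F₀ P' ≡ X → Set (m ⊔ ℓ)
  _⊑[_,_] P eP {P'} eP' = Σ[ f ∈ P ⇒ P' ] (∀ x → cast eP' (F₁ f x) ≡ cast eP x)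

  -- h^• B : the domain of the initial lift of the single-morphism source Uh : UA → UB
  single : ∀ {i} {A B : Obj} → A ⇒ B → Source {i} (F₀ A) (Lift i ⊤)
  single {B = B} h = record { dom = λ _ → B ; arr = λ _ → F₁ h }

  module _ {i} (top : IsTopological i) where
    open IsTopological top

    pullbackLift : ∀ {A B : Obj} (h : A ⇒ B) → InitialLift (single {i} h)
    pullbackLift {A} h = initialLift (F₀ A) (Lift i ⊤) (single h)

    _^• : ∀ {A B : Obj} (h : A ⇒ B) → Obj
    h ^• = InitialLift.obj (pullbackLift h)

    ^•-U : ∀ {A B : Obj} (h : A ⇒ B) → F₀ (h ^•) ≡ F₀ A
    ^•-U h = InitialLift.obj-U (pullbackLift h)

record SetMonad (ℓ : Level) : Set (lsuc ℓ) where
  field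
    T₀ : Set ℓ → Set ℓ
    T₁ : ∀ {X Y : Set ℓ} → (X → Y) → T₀ X → T₀ Y
    T-resp : ∀ {X Y : Set ℓ} {f g : X → Y} → (∀ x → f x ≡ g x) → ∀ t → T₁ f t ≡ T₁ g t
    T-id   : ∀ {X : Set ℓ} (t : T₀ X) → T₁ (λ x → x) t ≡ t
    T-∘    : ∀ {X Y Z : Set ℓ} (f : X → Y) (g : Y → Z) (t : T₀ X) →
             T₁ (λ x → g (f x)) t ≡ T₁ g (T₁ f t)
    η : ∀ {X : Set ℓ} → X → T₀ X
    μ : ∀ {X : Set ℓ} → T₀ (T₀ X) → T₀ X
    η-natural : ∀ {X Y : Set ℓ} (f : X → Y) (x : X) → T₁ f (η x) ≡ η (f x)
    μ-natural : ∀ {X Y : Set ℓ} (f : X → Y) (t : T₀ (T₀ X)) → T₁ f (μ t) ≡ μ (T₁ (T₁ f) t)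
    identityˡ : ∀ {X : Set ℓ} (t : T₀ X) → μ (T₁ η t) ≡ t
    identityʳ : ∀ {X : Set ℓ} (t : T₀ X) → μ (η t) ≡ t
    assoc     : ∀ {X : Set ℓ} (t : T₀ (T₀ (T₀ X))) → μ (T₁ μ t) ≡ μ (μ t)

record Monad {o m e} (E : Category o m e) : Set (o ⊔ m ⊔ e) where
  open Category E
  field
    F₀ : Obj → Obj
    F₁ : ∀ {A B} → A ⇒ B → F₀ A ⇒ F₀ B
    F-resp : ∀ {A B} {f g : A ⇒ B} → f ≈ g → F₁ f ≈ F₁ g
    F-id   : ∀ {A} → F₁ (id {A}) ≈ id
    F-∘    : ∀ {A B C} (f : A ⇒ B) (g : B ⇒ C) → F₁ (g ∘ f) ≈ F₁ g ∘ F₁ f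
    η : ∀ {A} → A ⇒ F₀ A
    μ : ∀ {A} → F₀ (F₀ A) ⇒ F₀ A
    η-natural : ∀ {A B} (f : A ⇒ B) → F₁ f ∘ η ≈ η ∘ f
    μ-natural : ∀ {A B} (f : A ⇒ B) → F₁ f ∘ μ ≈ μ ∘ F₁ (F₁ f)
    identityˡ : ∀ {A} → μ ∘ F₁ (η {A}) ≈ id
    identityʳ : ∀ {A} → μ ∘ η {F₀ A} ≈ id
    assoc     : ∀ {A} → μ ∘ F₁ (μ {A}) ≈ μ ∘ μ

  IsAlgebra : (C : Obj) → F₀ C ⇒ C → Set e
  IsAlgebra C c = (c ∘ η ≈ id) × (c ∘ F₁ c ≈ c ∘ μ)

  IsHomomorphism : ∀ {C D : Obj} → F₀ C ⇒ C → F₀ D ⇒ D → C ⇒ D → Set e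
  IsHomomorphism c d f = f ∘ c ≈ d ∘ F₁ f

  record Algebra : Set (o ⊔ m ⊔ e) where
    field
      carrier   : Obj
      act       : F₀ carrier ⇒ carrier
      isAlgebra : IsAlgebra carrier act

record IsLifting {o m e ℓ} {E : Category o m e} (U : SetFunctor E ℓ)
                 (T̄ : Monad E) (T : SetMonad ℓ) : Set (o ⊔ m ⊔ lsuc ℓ) where
  open Category E
  open SetFunctor U
  module T̄ = Monad T̄
  module T = SetMonad T
  field
    obj≡ : ∀ (A : Obj) → F₀ (T̄.F₀ A) ≡ T.T₀ (F₀ A)
    mor≡ : ∀ {A B} (f : A ⇒ B) (x : F₀ (T̄.F₀ A)) →
           cast (obj≡ B) (F₁ (T̄.F₁ f) x) ≡ T.T₁ (F₁ f) (cast (obj≡ A) x)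
    η≡   : ∀ {A} (x : F₀ A) → cast (obj≡ A) (F₁ (T̄.η {A}) x) ≡ T.η x
    μ≡   : ∀ {A} (x : F₀ (T̄.F₀ (T̄.F₀ A))) →
           cast (obj≡ A) (F₁ (T̄.μ {A}) x)
             ≡ T.μ (T.T₁ (cast (obj≡ A)) (cast (obj≡ (T̄.F₀ A)) x))

module _ {o m e ℓ} {E : Category o m e} (U : SetFunctor E ℓ) (T̄ : Monad E) where
  open Category E
  open SetFunctor U
  open Monad T̄ using (Algebra; IsAlgebra; IsHomomorphism) renaming (F₀ to T̄₀)

  IsRefinement : (A : Algebra) (P : Obj) → F₀ P ≡ F₀ (Algebra.carrier A) → Set (m ⊔ e ⊔ ℓ)
  IsRefinement A P eP =
    Σ[ ι ∈ _⊑[_,_] U (Algebra.carrier A) refl eP ]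
    Σ[ p ∈ T̄₀ P ⇒ P ]
      (IsAlgebra P p × IsHomomorphism (Algebra.act A) p (proj₁ ι))

{-# OPTIONS --safe #-}
-- On underlying sets h^•B is UA, so the only candidate structure map is Ua. It
-- underlies a morphism T̄(h^•B) → h^•B by initiality of h^•B, because after
-- composing with h^•B → B it becomes U(b ∘ T̄h) = U(h ∘ a). The algebra laws then
-- transfer from a along ι : A → h^•B: a topological functor is faithful, so maps
-- that are split epi on underlying sets, such as ι, T̄ι and T̄T̄ι, are epimorphisms
-- and can be cancelled.
module Submission where

open import Defs
open import Level using (Level; _⊔_; Lift; lift)
open import Data.Bool using (Bool; true; false)
open import Data.Unit using (tt)
open import Data.Product using (Σ-syntax; _,_; proj₁; proj₂)
open import Relation.Binary using (Setoid; IsEquivalence)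
open import Relation.Binary.PropositionalEquality
import Relation.Binary.Reasoning.Setoid as SetoidReasoning

cast-injective : ∀ {ℓ} {X Y : Set ℓ} (e : X ≡ Y) {x y : X} → cast e x ≡ cast e y → x ≡ y
cast-injective refl x≡y = x≡y

cast-sym-cast : ∀ {ℓ} {X Y : Set ℓ} (e : X ≡ Y) (x : X) → cast (sym e) (cast e x) ≡ x
cast-sym-cast refl x = refl

cast-cast-sym : ∀ {ℓ} {X Y : Set ℓ} (e : X ≡ Y) (y : Y) → cast e (cast (sym e) y) ≡ y
cast-cast-sym refl y = refl

module CategoryProperties {o m e} (E : Category o m e) where
  open Category E

  hom-setoid : Obj → Obj → Setoid m e
  hom-setoid X Y = record { Carrier = X ⇒ Y ; _≈_ = _≈_ ; isEquivalence = ≈-equiv }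

  open module ≈ {X Y : Obj} = IsEquivalence (≈-equiv {X} {Y})
    using () renaming (refl to ≈-refl; sym to ≈-sym; trans to ≈-trans) public

  Epi : ∀ {X Y} → X ⇒ Y → Set (o ⊔ m ⊔ e)
  Epi {Y = Y} f = ∀ {Z} (g k : Y ⇒ Z) → g ∘ f ≈ k ∘ f → g ≈ k

  section⇒Epi : ∀ {X Y} {f : X ⇒ Y} {s : Y ⇒ X} → f ∘ s ≈ id → Epi f
  section⇒Epi {Y = Y} {f = f} {s = s} f∘s≈id {Z} g k g∘f≈k∘f = begin
      g              ≈⟨ identityʳ ⟨
      g ∘ id         ≈⟨ ∘-resp-≈ ≈-refl f∘s≈id ⟨
      g ∘ (f ∘ s)    ≈⟨ assoc ⟨
      (g ∘ f) ∘ s    ≈⟨ ∘-resp-≈ g∘f≈k∘f ≈-refl ⟩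
      (k ∘ f) ∘ s    ≈⟨ assoc ⟩
      k ∘ (f ∘ s)    ≈⟨ ∘-resp-≈ ≈-refl f∘s≈id ⟩
      k ∘ id         ≈⟨ identityʳ ⟩
      k              ∎
    where open SetoidReasoning (hom-setoid Y Z)

  subst-dom : ∀ {X X′ Y} (p : X ≡ X′) (f : X ⇒ Y) →
              subst (_⇒ Y) p f ≈ f ∘ subst (_⇒ X) p id
  subst-dom refl f = ≈-sym identityʳ

  subst-id-section : ∀ {X X′} (p : X ≡ X′) → subst (_⇒ X) p id ∘ subst (X ⇒_) p id ≈ id
  subst-id-section refl = identityˡ

module MonadProperties {o m e} {E : Category o m e} (T̄ : Monad E) where
  open Category E
  open CategoryProperties E
  open Monad T̄ using (F₀; F₁; η; μ; IsAlgebra; IsHomomorphism)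
  module T̄ = Monad T̄

  isAlgebra-along-epi : ∀ {A P} {a : F₀ A ⇒ A} {p : F₀ P ⇒ P} {f : A ⇒ P} →
                        Epi f → Epi (F₁ (F₁ f)) → IsAlgebra A a → IsHomomorphism a p f →
                        IsAlgebra P p
  isAlgebra-along-epi {A} {P} {a} {p} {f} f-epi TTf-epi (a∘η≈id , a∘Ta≈a∘μ) f∘a≈p∘Tf =
    p∘η≈id , p∘Tp≈p∘μ
    where
      p∘η≈id : p ∘ η ≈ id
      p∘η≈id = f-epi _ _ (begin
          (p ∘ η) ∘ f      ≈⟨ assoc ⟩
          p ∘ (η ∘ f)      ≈⟨ ∘-resp-≈ ≈-refl (T̄.η-natural f) ⟨
          p ∘ (F₁ f ∘ η)   ≈⟨ assoc ⟨
          (p ∘ F₁ f) ∘ η   ≈⟨ ∘-resp-≈ f∘a≈p∘Tf ≈-refl ⟨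
          (f ∘ a) ∘ η      ≈⟨ assoc ⟩
          f ∘ (a ∘ η)      ≈⟨ ∘-resp-≈ ≈-refl a∘η≈id ⟩
          f ∘ id           ≈⟨ identityʳ ⟩
          f                ≈⟨ identityˡ ⟨
          id ∘ f           ∎)
        where open SetoidReasoning (hom-setoid A P)

      p∘Tp≈p∘μ : p ∘ F₁ p ≈ p ∘ μ
      p∘Tp≈p∘μ = TTf-epi _ _ (begin
          (p ∘ F₁ p) ∘ F₁ (F₁ f)   ≈⟨ assoc ⟩
          p ∘ (F₁ p ∘ F₁ (F₁ f))   ≈⟨ ∘-resp-≈ ≈-refl (T̄.F-∘ _ _) ⟨
          p ∘ F₁ (p ∘ F₁ f)        ≈⟨ ∘-resp-≈ ≈-refl (T̄.F-resp f∘a≈p∘Tf) ⟨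
          p ∘ F₁ (f ∘ a)           ≈⟨ ∘-resp-≈ ≈-refl (T̄.F-∘ _ _) ⟩
          p ∘ (F₁ f ∘ F₁ a)        ≈⟨ assoc ⟨
          (p ∘ F₁ f) ∘ F₁ a        ≈⟨ ∘-resp-≈ f∘a≈p∘Tf ≈-refl ⟨
          (f ∘ a) ∘ F₁ a           ≈⟨ assoc ⟩
          f ∘ (a ∘ F₁ a)           ≈⟨ ∘-resp-≈ ≈-refl a∘Ta≈a∘μ ⟩
          f ∘ (a ∘ μ)              ≈⟨ assoc ⟨
          (f ∘ a) ∘ μ              ≈⟨ ∘-resp-≈ f∘a≈p∘Tf ≈-refl ⟩
          (p ∘ F₁ f) ∘ μ           ≈⟨ assoc ⟩
          p ∘ (F₁ f ∘ μ)           ≈⟨ ∘-resp-≈ ≈-refl (T̄.μ-natural f) ⟩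
          p ∘ (μ ∘ F₁ (F₁ f))      ≈⟨ assoc ⟨
          (p ∘ μ) ∘ F₁ (F₁ f)      ∎)
        where open SetoidReasoning (hom-setoid (F₀ (F₀ A)) P)

module TopologicalProperties {o m e ℓ} {E : Category o m e} (U : SetFunctor E ℓ) where
  open Category E
  open CategoryProperties E
  open SetFunctor U

  USplitEpi : ∀ {X Y} → X ⇒ Y → Set ℓ
  USplitEpi {X} {Y} f = Σ[ s ∈ (F₀ Y → F₀ X) ] (∀ y → F₁ f (s y) ≡ y)

  ⊑⇒USplitEpi : ∀ {Z} {P P′ : Obj} {eP : F₀ P ≡ Z} {eP′ : F₀ P′ ≡ Z} →
                (P⊑P′ : _⊑[_,_] U P eP eP′) → USplitEpi (proj₁ P⊑P′)
  ⊑⇒USplitEpi {eP = eP} {eP′} (f , Uf≗id) =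
    (λ y → cast (sym eP) (cast eP′ y)) ,
    λ y → cast-injective eP′ (trans (Uf≗id _) (cast-cast-sym eP (cast eP′ y)))

  module _ {i} (top : IsTopological U i) where
    open IsTopological top

    -- Any k with Uk = Uf yields the lift (id, k) of the source (id, Uf), which is
    -- trivially initial; uniqueness of initial lifts then identifies f with g.
    faithful : ∀ {X Y} {f g : X ⇒ Y} → (∀ x → F₁ f x ≡ F₁ g x) → f ≈ g
    faithful {X} {Y} {f} {g} Uf≗Ug =
      section⇒Epi (subst-id-section p) f g (begin
        f ∘ subst (_⇒ X) p id      ≈⟨ subst-dom p f ⟨
        subst (_⇒ Y) p f           ≈⟨ proj₂ f≡chosen (lift false) ⟩
        chosen-mor (lift false)    ≈⟨ proj₂ g≡chosen (lift false) ⟨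
        subst (_⇒ Y) q g           ≈⟨ subst-dom q g ⟩
        g ∘ subst (_⇒ X) q id      ≈⟨ ∘-resp-≈ ≈-refl q≈p ⟩
        g ∘ subst (_⇒ X) p id      ∎)
      where
        graph : Source U (F₀ X) (Lift i Bool)
        graph = record { dom = λ { (lift true) → X ; (lift false) → Y }
                       ; arr = λ { (lift true) → λ x → x ; (lift false) → F₁ f } }

        graphLift : (k : X ⇒ Y) → (∀ x → F₁ k x ≡ F₁ f x) → InitialLift U graph
        graphLift k Uk≗Uf = record
          { lifted = record
            { obj = X ; obj-U = refl
            ; mor = λ { (lift true) → id ; (lift false) → k }
            ; mor-U = λ { (lift true) → F-id ; (lift false) → Uk≗Uf } }
          ; isInitial = λ _ _ factor → factor (lift true) }

        chosen : InitialLift U graph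
        chosen = initialLift (F₀ X) (Lift i Bool) graph

        chosen-mor : (k : Lift i Bool) → InitialLift.obj chosen ⇒ Source.dom graph k
        chosen-mor = InitialLift.mor chosen

        f-lift g-lift : InitialLift U graph
        f-lift = graphLift f (λ _ → refl)
        g-lift = graphLift g (λ x → sym (Uf≗Ug x))

        f≡chosen : SameLift U (InitialLift.lifted f-lift) (InitialLift.lifted chosen)
        f≡chosen = unique _ _ graph f-lift

        g≡chosen : SameLift U (InitialLift.lifted g-lift) (InitialLift.lifted chosen)
        g≡chosen = unique _ _ graph g-lift

        p q : X ≡ InitialLift.obj chosen
        p = proj₁ f≡chosen
        q = proj₁ g≡chosen

        q≈p : subst (_⇒ X) q id ≈ subst (_⇒ X) p id
        q≈p = ≈-trans (proj₂ g≡chosen (lift true)) (≈-sym (proj₂ f≡chosen (lift true)))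

        open SetoidReasoning (hom-setoid (InitialLift.obj chosen) Y)

    USplitEpi⇒Epi : ∀ {X Y} {f : X ⇒ Y} → USplitEpi f → Epi f
    USplitEpi⇒Epi {f = f} (s , Uf∘s≗id) g k g∘f≈k∘f = faithful λ y → begin
        F₁ g y               ≡⟨ cong (F₁ g) (Uf∘s≗id y) ⟨
        F₁ g (F₁ f (s y))    ≡⟨ F-∘ f g (s y) ⟨
        F₁ (g ∘ f) (s y)     ≡⟨ F-resp g∘f≈k∘f (s y) ⟩
        F₁ (k ∘ f) (s y)     ≡⟨ F-∘ f k (s y) ⟩
        F₁ k (F₁ f (s y))    ≡⟨ cong (F₁ k) (Uf∘s≗id y) ⟩
        F₁ k y               ∎
      where open ≡-Reasoning

    module _ {A B : Obj} (h : A ⇒ B) where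
      private
        pulled = pullbackLift U top h

      ^•-mor : _^• U top h ⇒ B
      ^•-mor = InitialLift.mor pulled (lift tt)

      ^•-mor-U : ∀ x → F₁ ^•-mor x ≡ F₁ h (cast (^•-U U top h) x)
      ^•-mor-U = InitialLift.mor-U pulled (lift tt)

      ^•-factor : ∀ {C} (φ : F₀ C → F₀ A) (k : C ⇒ B) → (∀ y → F₁ k y ≡ F₁ h (φ y)) →
                  Σ[ φ̄ ∈ C ⇒ _^• U top h ] (∀ y → cast (^•-U U top h) (F₁ φ̄ y) ≡ φ y)
      ^•-factor φ k Uk≗Uh∘φ = InitialLift.isInitial pulled _ φ (λ _ → k , Uk≗Uh∘φ)

      carrier⊑^• : _⊑[_,_] U A refl (^•-U U top h)
      carrier⊑^• = ^•-factor (λ x → x) h (λ _ → refl)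

module LiftingProperties {o m e ℓ} {E : Category o m e} {U : SetFunctor E ℓ}
                         {T̄ : Monad E} {T : SetMonad ℓ} (lifting : IsLifting U T̄ T) where
  open Category E
  open SetFunctor U
  open IsLifting lifting
  open TopologicalProperties U using (USplitEpi)
  open ≡-Reasoning

  -- T acting on maps of underlying sets, read through U T̄ = T U
  T₁ᵁ : ∀ {X Y} → (F₀ X → F₀ Y) → F₀ (T̄.F₀ X) → F₀ (T̄.F₀ Y)
  T₁ᵁ {X} {Y} φ t = cast (sym (obj≡ Y)) (T.T₁ φ (cast (obj≡ X) t))

  U-T̄₁ : ∀ {X Y} (f : X ⇒ Y) t → F₁ (T̄.F₁ f) t ≡ T₁ᵁ (F₁ f) t
  U-T̄₁ {Y = Y} f t = cast-injective (obj≡ Y)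
    (trans (mor≡ f t) (sym (cast-cast-sym (obj≡ Y) _)))

  T₁ᵁ-resp : ∀ {X Y} {φ ψ : F₀ X → F₀ Y} → (∀ x → φ x ≡ ψ x) → ∀ t → T₁ᵁ φ t ≡ T₁ᵁ ψ t
  T₁ᵁ-resp φ≗ψ t = cong (cast (sym (obj≡ _))) (T.T-resp φ≗ψ _)

  T₁ᵁ-id : ∀ {X} (t : F₀ (T̄.F₀ X)) → T₁ᵁ (λ x → x) t ≡ t
  T₁ᵁ-id {X} t = trans (cong (cast (sym (obj≡ X))) (T.T-id _)) (cast-sym-cast (obj≡ X) t)

  T₁ᵁ-∘ : ∀ {X Y Z} (φ : F₀ X → F₀ Y) (ψ : F₀ Y → F₀ Z) t →
          T₁ᵁ (λ x → ψ (φ x)) t ≡ T₁ᵁ ψ (T₁ᵁ φ t)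
  T₁ᵁ-∘ {X} {Y} {Z} φ ψ t = cong (cast (sym (obj≡ Z))) (begin
      T.T₁ (λ x → ψ (φ x)) t′                                   ≡⟨ T.T-∘ φ ψ t′ ⟩
      T.T₁ ψ (T.T₁ φ t′)                                         ≡⟨ cong (T.T₁ ψ) (cast-cast-sym (obj≡ Y) _) ⟨
      T.T₁ ψ (cast (obj≡ Y) (cast (sym (obj≡ Y)) (T.T₁ φ t′)))  ∎)
    where t′ = cast (obj≡ X) t

  T̄-USplitEpi : ∀ {X Y} {f : X ⇒ Y} → USplitEpi f → USplitEpi (T̄.F₁ f)
  T̄-USplitEpi {f = f} (s , Uf∘s≗id) = T₁ᵁ s , λ t → begin
      F₁ (T̄.F₁ f) (T₁ᵁ s t)           ≡⟨ U-T̄₁ f _ ⟩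
      T₁ᵁ (F₁ f) (T₁ᵁ s t)            ≡⟨ T₁ᵁ-∘ s (F₁ f) t ⟨
      T₁ᵁ (λ y → F₁ f (s y)) t        ≡⟨ T₁ᵁ-resp Uf∘s≗id t ⟩
      T₁ᵁ (λ y → y) t                 ≡⟨ T₁ᵁ-id t ⟩
      t                               ∎

module PulledBackStructure {o m e ℓ i} {E : Category o m e} {U : SetFunctor E ℓ}
    (top : IsTopological U i) {T̄ : Monad E} {T : SetMonad ℓ} (lifting : IsLifting U T̄ T)
    (A B : Monad.Algebra T̄)
    (h : Category._⇒_ E (Monad.Algebra.carrier A) (Monad.Algebra.carrier B))
    (hom : Monad.IsHomomorphism T̄ (Monad.Algebra.act A) (Monad.Algebra.act B) h) where
  open Category E
  open SetFunctor U
  open TopologicalProperties U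
  open LiftingProperties lifting
  open Monad.Algebra A using () renaming (act to a)
  open Monad.Algebra B using () renaming (act to b)
  module T̄ = Monad T̄
  open ≡-Reasoning

  u : F₀ (_^• U top h) → F₀ (Monad.Algebra.carrier A)
  u = cast (^•-U U top h)

  ι : Monad.Algebra.carrier A ⇒ _^• U top h
  ι = proj₁ (carrier⊑^• top h)

  ι-U : ∀ x → u (F₁ ι x) ≡ x
  ι-U = proj₂ (carrier⊑^• top h)

  ι-USplitEpi : USplitEpi ι
  ι-USplitEpi = ⊑⇒USplitEpi (carrier⊑^• top h)

  U-b∘T̄^•-mor : ∀ t → F₁ (b ∘ T̄.F₁ (^•-mor top h)) t ≡ F₁ h (F₁ a (T₁ᵁ u t))
  U-b∘T̄^•-mor t = begin
      F₁ (b ∘ T̄.F₁ (^•-mor top h)) t          ≡⟨ F-∘ _ b t ⟩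
      F₁ b (F₁ (T̄.F₁ (^•-mor top h)) t)       ≡⟨ cong (F₁ b) (U-T̄₁ _ t) ⟩
      F₁ b (T₁ᵁ (F₁ (^•-mor top h)) t)        ≡⟨ cong (F₁ b) (T₁ᵁ-resp (^•-mor-U top h) t) ⟩
      F₁ b (T₁ᵁ (λ x → F₁ h (u x)) t)         ≡⟨ cong (F₁ b) (T₁ᵁ-∘ u (F₁ h) t) ⟩
      F₁ b (T₁ᵁ (F₁ h) (T₁ᵁ u t))             ≡⟨ cong (F₁ b) (U-T̄₁ h _) ⟨
      F₁ b (F₁ (T̄.F₁ h) (T₁ᵁ u t))            ≡⟨ F-∘ _ b _ ⟨
      F₁ (b ∘ T̄.F₁ h) (T₁ᵁ u t)               ≡⟨ F-resp hom _ ⟨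
      F₁ (h ∘ a) (T₁ᵁ u t)                    ≡⟨ F-∘ a h _ ⟩
      F₁ h (F₁ a (T₁ᵁ u t))                   ∎

  private
    act-lift : Σ[ act ∈ T̄.F₀ (_^• U top h) ⇒ _^• U top h ] (∀ t → u (F₁ act t) ≡ F₁ a (T₁ᵁ u t))
    act-lift = ^•-factor top h (λ t → F₁ a (T₁ᵁ u t)) _ U-b∘T̄^•-mor

  act : T̄.F₀ (_^• U top h) ⇒ _^• U top h
  act = proj₁ act-lift

  act-U : ∀ t → u (F₁ act t) ≡ F₁ a (T₁ᵁ u t)
  act-U = proj₂ act-lift

  ι-homomorphism : T̄.IsHomomorphism a act ι
  ι-homomorphism = faithful top λ t → cast-injective (^•-U U top h) (begin
      u (F₁ (ι ∘ a) t)                      ≡⟨ cong u (F-∘ a ι t) ⟩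
      u (F₁ ι (F₁ a t))                     ≡⟨ ι-U _ ⟩
      F₁ a t                                ≡⟨ cong (F₁ a) (T₁ᵁ-id t) ⟨
      F₁ a (T₁ᵁ (λ x → x) t)                ≡⟨ cong (F₁ a) (T₁ᵁ-resp ι-U t) ⟨
      F₁ a (T₁ᵁ (λ x → u (F₁ ι x)) t)       ≡⟨ cong (F₁ a) (T₁ᵁ-∘ (F₁ ι) u t) ⟩
      F₁ a (T₁ᵁ u (T₁ᵁ (F₁ ι) t))           ≡⟨ cong (λ t′ → F₁ a (T₁ᵁ u t′)) (U-T̄₁ ι t) ⟨
      F₁ a (T₁ᵁ u (F₁ (T̄.F₁ ι) t))          ≡⟨ act-U _ ⟨
      u (F₁ act (F₁ (T̄.F₁ ι) t))            ≡⟨ cong u (F-∘ (T̄.F₁ ι) act t) ⟨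
      u (F₁ (act ∘ T̄.F₁ ι) t)               ∎)

lemma3p4 : ∀ {o m e ℓ i : Level} (E : Category o m e) (U : SetFunctor E ℓ)
             (top : IsTopological U i) (T̄ : Monad E) (T : SetMonad ℓ)
             (lifting : IsLifting U T̄ T)
             (A B : Monad.Algebra T̄)
             (h : Category._⇒_ E (Monad.Algebra.carrier A) (Monad.Algebra.carrier B)) →
             Monad.IsHomomorphism T̄ (Monad.Algebra.act A) (Monad.Algebra.act B) h →
             IsRefinement U T̄ A (_^• U top h) (^•-U U top h)
lemma3p4 E U top T̄ T lifting A B h hom = carrier⊑^• top h , act , act-isAlgebra , ι-homomorphism
  where
    open TopologicalProperties U
    open LiftingProperties lifting
    open MonadProperties T̄
    open PulledBackStructure top lifting A B h hom

    act-isAlgebra : Monad.IsAlgebra T̄ (_^• U top h) act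
    act-isAlgebra = isAlgebra-along-epi (USplitEpi⇒Epi top ι-USplitEpi)
                      (USplitEpi⇒Epi top (T̄-USplitEpi (T̄-USplitEpi ι-USplitEpi)))
                      (Monad.Algebra.isAlgebra A) ι-homomorphism
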